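{- Let $A$ be an abelian group of order $v\equiv 2$ or $4\pmod 6$ whose Sylow $2$-subgroup is cyclic, let $h_0$ be the (unique) element of order $2$ in $A$, and let $\mathcal B_0$ be defined with respect to $h_0$ as in the context. If $(A,\mathcal B)$ is an $A$-reversible $\mathrm{SQS}(v)$, then $\mathcal B_0\subseteq\mathcal B$.
   Context: For a finite abelian group $A$ (additive), $\hat A$ is the permutation group on $A$ generated by translations $x\mapsto x+a$ and $x\mapsto -x$; the $\hat A$-orbit of $X\subseteq A$ is $\{X+a\}_{a\in A}\cup\{ -X+a\}_{a\in A}$, and $[a_1,\dots,a_t]$ denotes the $\hat A$-orbit of $\{0,a_1,\dots,a_t\}$. $\Omega_1(A)=\{a\in A: 2a=0\}$. $\mathcal Q_1=\{[a,-a,h_0]: a\in A\setminus\Omega_1(A)\}$, $\mathcal Q_2=\{[a,h,h+a]: a\in A\setminus\Omega_1(A),\ h\in\Omega_1(A)\setminus\{0,h_0\},\ 2a\ne h\}$, $\mathcal Q_3=\{[h,h',h+h']: h,h'\in\Omega_1(A)\setminus\{0\},\ h\ne h'\}$, and $\mathcal B_0$ is the set of $4$-subsets of $A$ whose $\hat A$-orbit lies in $\mathcal Q_1\cup\mathcal Q_2\cup\mathcal Q_3$. An $\mathrm{SQS}(v)$ on point set $A$ is a family of $4$-subsets (blocks) with every $3$-subset of $A$ in exactly one block; it is $A$-reversible if every block $B$ is symmetric ($B=-B+x$ for some $x\in A$) and the block set is $\hat A$-invariant. -}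

module Defs where

open import Data.Nat using (ℕ; zero; suc; _^_)
open import Data.Fin using (Fin)
open import Data.Fin.Subset using (Subset; _∈_; _⊆_; ∣_∣; ⁅_⁆; _∪_)
open import Data.Vec using (tabulate; lookup)
open import Data.Product using (Σ; ∃; _×_; _,_)
open import Data.Sum using (_⊎_)
open import Relation.Binary.PropositionalEquality using (_≡_; _≢_)
open import Relation.Nullary using (¬_)
open import Function.Bundles using (_⇔_)
open import Algebra.Structures using (IsAbelianGroup)

-- A finite abelian group of order v, written additively, with carrier Fin v
-- (every finite abelian group of order v is isomorphic to one of this form).
record FinAbGroup (v : ℕ) : Set where
  infixl 6 _+_
  field
    _+_ : Fin v → Fin v → Fin v
    0#  : Fin v
    -_  : Fin v → Fin v
    isAbelianGroup : IsAbelianGroup _≡_ _+_ 0# -_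

module GroupNotions {v : ℕ} (G : FinAbGroup v) where
  open FinAbGroup G

  _·_ : ℕ → Fin v → Fin v
  zero  · x = 0#
  suc n · x = x + (n · x)

  InΩ₁ : Fin v → Set
  InΩ₁ a = a + a ≡ 0#

  OrderTwo : Fin v → Set
  OrderTwo h = (h ≢ 0#) × (h + h ≡ 0#)

  InSylow2 : Fin v → Set
  InSylow2 x = ∃ λ k → (2 ^ k) · x ≡ 0#

  Sylow2Cyclic : Set
  Sylow2Cyclic = ∃ λ g → InSylow2 g × (∀ x → InSylow2 x → ∃ λ n → x ≡ n · g)

  translate : Subset v → Fin v → Subset v
  translate X a = tabulate (λ y → lookup X (y + (- a)))

  negate : Subset v → Subset v
  negate X = tabulate (λ y → lookup X (- y))

  InOrbit : Subset v → Subset v → Set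
  InOrbit X Y = ∃ λ a → (Y ≡ translate X a) ⊎ (Y ≡ translate (negate X) a)

  SameOrbit : Subset v → Subset v → Set
  SameOrbit X Y = ∀ Z → (InOrbit X Z ⇔ InOrbit Y Z)

  quad : Fin v → Fin v → Fin v → Subset v
  quad a b c = ⁅ 0# ⁆ ∪ (⁅ a ⁆ ∪ (⁅ b ⁆ ∪ ⁅ c ⁆))

  InQ₁ : Fin v → Subset v → Set
  InQ₁ h₀ X = ∃ λ a → ¬ InΩ₁ a × SameOrbit X (quad a (- a) h₀)

  InQ₂ : Fin v → Subset v → Set
  InQ₂ h₀ X = ∃ λ a → ∃ λ h →
    ¬ InΩ₁ a × InΩ₁ h × h ≢ 0# × h ≢ h₀ × (a + a) ≢ h
    × SameOrbit X (quad a h (h + a))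

  InQ₃ : Subset v → Set
  InQ₃ X = ∃ λ h → ∃ λ h' →
    InΩ₁ h × InΩ₁ h' × h ≢ 0# × h' ≢ 0# × h ≢ h'
    × SameOrbit X (quad h h' (h + h'))

  InB₀ : Fin v → Subset v → Set
  InB₀ h₀ X = ∣ X ∣ ≡ 4 × (InQ₁ h₀ X ⊎ InQ₂ h₀ X ⊎ InQ₃ X)

  IsSQS : (Subset v → Set) → Set
  IsSQS 𝓑 =
    (∀ B → 𝓑 B → ∣ B ∣ ≡ 4)
    × (∀ T → ∣ T ∣ ≡ 3 →
         (∃ λ B → 𝓑 B × T ⊆ B)
         × (∀ B B' → 𝓑 B → 𝓑 B' → T ⊆ B → T ⊆ B' → B ≡ B'))

  Symmetric : Subset v → Set
  Symmetric B = ∃ λ x → B ≡ translate (negate B) x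

  -- A-reversible: all blocks symmetric, block set invariant under Â
  -- (equivalently under its generators: translations and x ↦ -x)
  Reversible : (Subset v → Set) → Set
  Reversible 𝓑 =
    (∀ B → 𝓑 B → Symmetric B)
    × (∀ B → 𝓑 B → ∀ a → 𝓑 (translate B a))
    × (∀ B → 𝓑 B → 𝓑 (negate B))

-- The Sylow 2-subgroup ⟨g⟩ is cyclic, so A has exactly one involution h₀: an involution n·g
-- with n odd forces g + g = 0, and otherwise it is a multiple of g + g, whose 2-power order is
-- smaller.  Hence Ω₁(A) = {0, h₀}, so 𝒬₂ and 𝒬₃ are empty.  For a ∉ Ω₁(A) the block B
-- through the 3-set {0, a, -a} is mapped by x ↦ -x to a block through the same 3-set, so
-- B = -B; its fourth point x then satisfies x = -x, i.e. x = h₀.  Thus {0, a, -a, h₀} is a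
-- block, and so is every set in its Â-orbit.
module Submission where

open import Algebra.Bundles using (AbelianGroup)
import Algebra.Properties.CommutativeMonoid.Mult as Mult
import Algebra.Properties.Group as GroupProperties
open import Data.Empty using (⊥-elim)
open import Data.Fin using (Fin; zero; suc; _≟_)
open import Data.Fin.Subset using (Subset; _∈_; _∉_; _⊆_; ∣_∣; ⁅_⁆; _∪_; inside; outside)
open import Data.Fin.Subset.Properties
  using (∪-identityˡ; x∈⁅x⁆; x∈⁅y⁆⇒x≡y; ∣⁅x⁆∣≡1; x∈p∪q⁺; x∈p∪q⁻; _∈?_; ⊆-antisym; p⊆q⇒∣p∣≤∣q∣)
open import Data.Nat as ℕ using (ℕ; zero; suc; _^_; _≤_; _%_)
open import Data.Nat.Properties using (+-suc; +-identityʳ; 1+n≰n; ≤-refl; ≤-trans)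
open import Data.Product using (∃; _,_; proj₁; proj₂)
open import Data.Sum using (_⊎_; inj₁; inj₂; [_,_])
import Data.Sum as Sum
open import Data.Vec using (_∷_; lookup)
open import Data.Vec.Base using (here; there)
open import Data.Vec.Properties using (lookup∘tabulate; tabulate∘lookup; tabulate-cong; []=⇒lookup; lookup⇒[]=)
open import Function using (_∘_)
open import Function.Bundles using (Equivalence)
open import Level using (0ℓ)
open import Relation.Nullary using (¬_; yes; no; contradiction)
open import Relation.Binary.PropositionalEquality using (_≡_; _≢_; refl; sym; trans; cong; subst; subst₂; module ≡-Reasoning)
open import Defs

private variable
  n : ℕ
  x y : Fin n
  p : Subset n

x∈⁅y⁆∪p⁻ : x ∈ ⁅ y ⁆ ∪ p → x ≡ y ⊎ x ∈ p
x∈⁅y⁆∪p⁻ {y = y} {p = p} = Sum.map₁ (x∈⁅y⁆⇒x≡y y) ∘ x∈p∪q⁻ ⁅ y ⁆ p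

x∈⁅y⁆∪p⁺ : x ≡ y ⊎ x ∈ p → x ∈ ⁅ y ⁆ ∪ p
x∈⁅y⁆∪p⁺ = x∈p∪q⁺ ∘ Sum.map₁ (λ { refl → x∈⁅x⁆ _ })

x∉⁅y⁆∪p : x ≢ y → x ∉ p → x ∉ ⁅ y ⁆ ∪ p
x∉⁅y⁆∪p x≢y x∉p = [ x≢y , x∉p ] ∘ x∈⁅y⁆∪p⁻

x∉p⇒∣⁅x⁆∪p∣≡1+∣p∣ : x ∉ p → ∣ ⁅ x ⁆ ∪ p ∣ ≡ suc ∣ p ∣
x∉p⇒∣⁅x⁆∪p∣≡1+∣p∣ {x = zero}  {p = inside  ∷ p} x∉p = contradiction here x∉p
x∉p⇒∣⁅x⁆∪p∣≡1+∣p∣ {x = zero}  {p = outside ∷ p} x∉p = cong (suc ∘ ∣_∣) (∪-identityˡ p)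
x∉p⇒∣⁅x⁆∪p∣≡1+∣p∣ {x = suc x} {p = inside  ∷ p} x∉p = cong suc (x∉p⇒∣⁅x⁆∪p∣≡1+∣p∣ (x∉p ∘ there))
x∉p⇒∣⁅x⁆∪p∣≡1+∣p∣ {x = suc x} {p = outside ∷ p} x∉p = x∉p⇒∣⁅x⁆∪p∣≡1+∣p∣ (x∉p ∘ there)

data Parity : ℕ → Set where
  even : ∀ m → Parity (m ℕ.+ m)
  odd  : ∀ m → Parity (suc (m ℕ.+ m))

parity : ∀ n → Parity n
parity zero = even 0
parity (suc n) with parity n
... | even m = odd m
... | odd m  = subst Parity (cong suc (+-suc m m)) (even (suc m))

module _ {v : ℕ} (G : FinAbGroup v) where
  open FinAbGroup G
  open GroupNotions G

  private
    abelianGroup : AbelianGroup 0ℓ 0ℓ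
    abelianGroup = record { isAbelianGroup = isAbelianGroup }

  open AbelianGroup abelianGroup using (identityʳ; inverseˡ; group; commutativeMonoid)
  open GroupProperties group using (ε⁻¹≈ε; ⁻¹-involutive)
  open Mult commutativeMonoid using (_×_; ×-homo-+; ×-distrib-+)

  ·≗× : ∀ n x → n · x ≡ n × x
  ·≗× zero    x = refl
  ·≗× (suc n) x = cong (x +_) (·≗× n x)

  ·-homo-+ : ∀ m n x → (m ℕ.+ n) · x ≡ m · x + n · x
  ·-homo-+ m n x rewrite ·≗× (m ℕ.+ n) x | ·≗× m x | ·≗× n x = ×-homo-+ x m n

  ·-distrib-+ : ∀ n x y → n · (x + y) ≡ n · x + n · y
  ·-distrib-+ n x y rewrite ·≗× n (x + y) | ·≗× n x | ·≗× n y = ×-distrib-+ x y n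

  ·-zeroʳ : ∀ n → n · 0# ≡ 0#
  ·-zeroʳ zero    = refl
  ·-zeroʳ (suc n) = trans (cong (0# +_) (·-zeroʳ n)) (identityʳ 0#)

  ·-double : ∀ n x → n · (x + x) ≡ (n ℕ.+ n) · x
  ·-double n x = trans (·-distrib-+ n x x) (sym (·-homo-+ n n x))

  2^k·[x+x]≡2^1+k·x : ∀ k x → (2 ^ k) · (x + x) ≡ (2 ^ suc k) · x
  2^k·[x+x]≡2^1+k·x k x = trans (·-double (2 ^ k) x) (cong (λ m → (2 ^ k ℕ.+ m) · x) (sym (+-identityʳ (2 ^ k))))

  1·x≡x : ∀ x → 1 · x ≡ x
  1·x≡x = identityʳ

  ≡-⇒InΩ₁ : ∀ {y} → y ≡ - y → InΩ₁ y
  ≡-⇒InΩ₁ {y} y≡-y = trans (cong (_+ y) y≡-y) (inverseˡ y)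

  InΩ₁⇒InSylow2 : ∀ {y} → InΩ₁ y → InSylow2 y
  InΩ₁⇒InSylow2 {y} y+y≡0 = 1 , trans (cong (y +_) (1·x≡x y)) y+y≡0

  odd-multiple≡0⇒≡0 : ∀ k m {u} → (2 ^ k) · u ≡ 0# → suc (m ℕ.+ m) · u ≡ 0# → u ≡ 0#
  odd-multiple≡0⇒≡0 zero    m {u} 1·u≡0 _ = trans (sym (1·x≡x u)) 1·u≡0
  odd-multiple≡0⇒≡0 (suc k) m {u} 2^1+k·u≡0 odd·u≡0 = begin
    u                          ≡⟨ sym (identityʳ u) ⟩
    u + 0#                     ≡⟨ cong (u +_) (sym (·-zeroʳ m)) ⟩
    u + m · 0#                 ≡⟨ cong (λ z → u + m · z) (sym u+u≡0) ⟩
    u + m · (u + u)            ≡⟨ cong (u +_) (·-double m u) ⟩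
    suc (m ℕ.+ m) · u          ≡⟨ odd·u≡0 ⟩
    0#                         ∎
    where
    open ≡-Reasoning
    u+u≡0 : u + u ≡ 0#
    u+u≡0 = odd-multiple≡0⇒≡0 k m (trans (2^k·[x+x]≡2^1+k·x k u) 2^1+k·u≡0)
              (trans (·-distrib-+ (suc (m ℕ.+ m)) u u) (trans (cong (λ z → z + z) odd·u≡0) (identityʳ 0#)))

  InΩ₁⇒multiple≡0∨self : ∀ {g} → InΩ₁ g → ∀ n → n · g ≡ 0# ⊎ n · g ≡ g
  InΩ₁⇒multiple≡0∨self g+g≡0 zero = inj₁ refl
  InΩ₁⇒multiple≡0∨self {g} g+g≡0 (suc n) with InΩ₁⇒multiple≡0∨self g+g≡0 n
  ... | inj₁ n·g≡0 = inj₂ (trans (cong (g +_) n·g≡0) (identityʳ g))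
  ... | inj₂ n·g≡g = inj₁ (trans (cong (g +_) n·g≡g) g+g≡0)

  InΩ₁-multiple⇒multiple-of-double : ∀ k {g} → (2 ^ suc k) · g ≡ 0# → g + g ≢ 0# →
    ∀ n → InΩ₁ (n · g) → ∃ λ m → n · g ≡ m · (g + g)
  InΩ₁-multiple⇒multiple-of-double k {g} 2^1+k·g≡0 g+g≢0 n n·g∈Ω₁ with parity n
  ... | even m = m , sym (·-double m g)
  ... | odd m  = contradiction
    (odd-multiple≡0⇒≡0 k m (trans (2^k·[x+x]≡2^1+k·x k g) 2^1+k·g≡0) (trans (·-distrib-+ n g g) n·g∈Ω₁)) g+g≢0

  involution-multiples-unique : ∀ k g → (2 ^ k) · g ≡ 0# → ∀ n n' →
    OrderTwo (n · g) → OrderTwo (n' · g) → n · g ≡ n' · g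
  involution-multiples-unique k g 2^k·g≡0 n n' y y' with g + g ≟ 0#
  ... | yes g+g≡0 = trans (multiple≡g n y) (sym (multiple≡g n' y'))
    where
    multiple≡g : ∀ n → OrderTwo (n · g) → n · g ≡ g
    multiple≡g n (n·g≢0 , _) = Sum.fromInj₂ (⊥-elim ∘ n·g≢0) (InΩ₁⇒multiple≡0∨self g+g≡0 n)
  involution-multiples-unique zero g 1·g≡0 n n' y y' | no g+g≢0 =
    contradiction (trans (cong (λ z → z + z) g≡0) (identityʳ 0#)) g+g≢0
    where
    g≡0 : g ≡ 0#
    g≡0 = trans (sym (1·x≡x g)) 1·g≡0
  involution-multiples-unique (suc k) g 2^1+k·g≡0 n n' y y' | no g+g≢0
    with InΩ₁-multiple⇒multiple-of-double k 2^1+k·g≡0 g+g≢0 n (proj₂ y)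
       | InΩ₁-multiple⇒multiple-of-double k 2^1+k·g≡0 g+g≢0 n' (proj₂ y')
  ... | m , n·g≡m·2g | m' , n'·g≡m'·2g = begin
    n · g        ≡⟨ n·g≡m·2g ⟩
    m · (g + g)  ≡⟨ involution-multiples-unique k (g + g) (trans (2^k·[x+x]≡2^1+k·x k g) 2^1+k·g≡0) m m'
                      (subst OrderTwo n·g≡m·2g y) (subst OrderTwo n'·g≡m'·2g y') ⟩
    m' · (g + g) ≡⟨ sym n'·g≡m'·2g ⟩
    n' · g       ∎
    where open ≡-Reasoning

  UniqueInvolution : Fin v → Set
  UniqueInvolution h = ∀ y → InΩ₁ y → y ≡ 0# ⊎ y ≡ h

  Sylow2Cyclic⇒UniqueInvolution : Sylow2Cyclic → ∀ {h₀} → OrderTwo h₀ → UniqueInvolution h₀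
  Sylow2Cyclic⇒UniqueInvolution (g , (k , 2^k·g≡0) , generates) {h₀} h₀-order-two y y∈Ω₁
    with y ≟ 0#
  ... | yes y≡0 = inj₁ y≡0
  ... | no y≢0
    with generates y (InΩ₁⇒InSylow2 y∈Ω₁) | generates h₀ (InΩ₁⇒InSylow2 (proj₂ h₀-order-two))
  ... | n , y≡n·g | n₀ , h₀≡n₀·g = inj₂ (begin
    y       ≡⟨ y≡n·g ⟩
    n · g   ≡⟨ involution-multiples-unique k g 2^k·g≡0 n n₀
                 (subst OrderTwo y≡n·g (y≢0 , y∈Ω₁)) (subst OrderTwo h₀≡n₀·g h₀-order-two) ⟩
    n₀ · g  ≡⟨ sym h₀≡n₀·g ⟩
    h₀      ∎)
    where open ≡-Reasoning

  module _ {h₀} (unique : UniqueInvolution h₀) where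

    UniqueInvolution⇒¬InQ₂ : ∀ X → ¬ InQ₂ h₀ X
    UniqueInvolution⇒¬InQ₂ X (_ , h , _ , h∈Ω₁ , h≢0 , h≢h₀ , _) = [ h≢0 , h≢h₀ ] (unique h h∈Ω₁)

    UniqueInvolution⇒¬InQ₃ : ∀ X → ¬ InQ₃ X
    UniqueInvolution⇒¬InQ₃ X (h , h' , h∈Ω₁ , h'∈Ω₁ , h≢0 , h'≢0 , h≢h' , _)
      with unique h h∈Ω₁ | unique h' h'∈Ω₁
    ... | inj₁ h≡0  | _          = h≢0 h≡0
    ... | inj₂ _    | inj₁ h'≡0  = h'≢0 h'≡0
    ... | inj₂ h≡h₀ | inj₂ h'≡h₀ = h≢h' (trans h≡h₀ (sym h'≡h₀))

  NegationClosed : Subset v → Set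
  NegationClosed S = ∀ {y} → y ∈ S → - y ∈ S

  ∈-negate⁺ : ∀ {B y} → - y ∈ B → y ∈ negate B
  ∈-negate⁺ {B} {y} -y∈B =
    lookup⇒[]= y (negate B) (trans (lookup∘tabulate (λ z → lookup B (- z)) y) ([]=⇒lookup -y∈B))

  ∈-negate⁻ : ∀ {B y} → y ∈ negate B → - y ∈ B
  ∈-negate⁻ {B} {y} y∈-B =
    lookup⇒[]= (- y) B (trans (sym (lookup∘tabulate (λ z → lookup B (- z)) y)) ([]=⇒lookup y∈-B))

  translate-identity : ∀ X → translate X 0# ≡ X
  translate-identity X =
    trans (tabulate-cong (λ y → cong (lookup X) (trans (cong (y +_) ε⁻¹≈ε) (identityʳ y)))) (tabulate∘lookup X)

  outside-point-self-inverse : ∀ {T B} → NegationClosed T → NegationClosed B → T ⊆ B →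
    ∣ B ∣ ≤ suc ∣ T ∣ → ∀ {y} → y ∈ B → y ∉ T → y ≡ - y
  outside-point-self-inverse {T} {B} T-closed B-closed T⊆B ∣B∣≤1+∣T∣ {y} y∈B y∉T with y ≟ - y
  ... | yes y≡-y = y≡-y
  ... | no y≢-y  = contradiction
    (subst (_≤ suc ∣ T ∣) ∣W∣≡2+∣T∣ (≤-trans (p⊆q⇒∣p∣≤∣q∣ W⊆B) ∣B∣≤1+∣T∣)) 1+n≰n
    where
    W : Subset v
    W = ⁅ - y ⁆ ∪ (⁅ y ⁆ ∪ T)
    -y∉T : - y ∉ T
    -y∉T -y∈T = y∉T (subst (_∈ T) (⁻¹-involutive y) (T-closed -y∈T))
    ∣W∣≡2+∣T∣ : ∣ W ∣ ≡ suc (suc ∣ T ∣)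
    ∣W∣≡2+∣T∣ = trans (x∉p⇒∣⁅x⁆∪p∣≡1+∣p∣ (x∉⁅y⁆∪p (y≢-y ∘ sym) -y∉T))
                      (cong suc (x∉p⇒∣⁅x⁆∪p∣≡1+∣p∣ y∉T))
    W⊆B : W ⊆ B
    W⊆B x∈W with x∈⁅y⁆∪p⁻ x∈W
    ... | inj₁ refl = B-closed y∈B
    ... | inj₂ x∈⁅y⁆∪T with x∈⁅y⁆∪p⁻ x∈⁅y⁆∪T
    ... | inj₁ refl = y∈B
    ... | inj₂ x∈T  = T⊆B x∈T

  triangle : Fin v → Subset v
  triangle a = ⁅ 0# ⁆ ∪ (⁅ a ⁆ ∪ ⁅ - a ⁆)

  ∈triangle⁺ : ∀ {a y} → y ≡ 0# ⊎ y ≡ a ⊎ y ≡ - a → y ∈ triangle a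
  ∈triangle⁺ = x∈⁅y⁆∪p⁺ ∘ Sum.map₂ (x∈⁅y⁆∪p⁺ ∘ Sum.map₂ (λ { refl → x∈⁅x⁆ _ }))

  ∈triangle⁻ : ∀ {a y} → y ∈ triangle a → y ≡ 0# ⊎ y ≡ a ⊎ y ≡ - a
  ∈triangle⁻ {a} = Sum.map₂ (Sum.map₂ (x∈⁅y⁆⇒x≡y (- a)) ∘ x∈⁅y⁆∪p⁻) ∘ x∈⁅y⁆∪p⁻

  triangle-closed : ∀ a → NegationClosed (triangle a)
  triangle-closed a y∈T with ∈triangle⁻ y∈T
  ... | inj₁ refl        = ∈triangle⁺ (inj₁ ε⁻¹≈ε)
  ... | inj₂ (inj₁ refl) = ∈triangle⁺ (inj₂ (inj₂ refl))
  ... | inj₂ (inj₂ refl) = ∈triangle⁺ (inj₂ (inj₁ (⁻¹-involutive a)))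

  ∣triangle∣≡3 : ∀ {a} → ¬ InΩ₁ a → ∣ triangle a ∣ ≡ 3
  ∣triangle∣≡3 {a} a∉Ω₁ =
    trans (x∉p⇒∣⁅x⁆∪p∣≡1+∣p∣ (x∉⁅y⁆∪p (a≢0 ∘ sym) (-a≢0 ∘ sym ∘ x∈⁅y⁆⇒x≡y (- a))))
          (cong suc (trans (x∉p⇒∣⁅x⁆∪p∣≡1+∣p∣ (a∉Ω₁ ∘ ≡-⇒InΩ₁ ∘ x∈⁅y⁆⇒x≡y (- a)))
                           (cong suc (∣⁅x⁆∣≡1 (- a)))))
    where
    a≢0 : a ≢ 0#
    a≢0 refl = a∉Ω₁ (identityʳ 0#)
    -a≢0 : - a ≢ 0#
    -a≢0 -a≡0 = a≢0 (trans (sym (⁻¹-involutive a)) (trans (cong -_ -a≡0) ε⁻¹≈ε))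

  ∈quad⁺ : ∀ {a b c y} → y ≡ 0# ⊎ y ≡ a ⊎ y ≡ b ⊎ y ≡ c → y ∈ quad a b c
  ∈quad⁺ = x∈⁅y⁆∪p⁺ ∘ Sum.map₂ (x∈⁅y⁆∪p⁺ ∘ Sum.map₂ (x∈⁅y⁆∪p⁺ ∘ Sum.map₂ (λ { refl → x∈⁅x⁆ _ })))

  ∈quad⁻ : ∀ {a b c y} → y ∈ quad a b c → y ≡ 0# ⊎ y ≡ a ⊎ y ≡ b ⊎ y ≡ c
  ∈quad⁻ {c = c} = Sum.map₂ (Sum.map₂ (Sum.map₂ (x∈⁅y⁆⇒x≡y c) ∘ x∈⁅y⁆∪p⁻) ∘ x∈⁅y⁆∪p⁻) ∘ x∈⁅y⁆∪p⁻

  triangle⊆quad : ∀ a h → triangle a ⊆ quad a (- a) h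
  triangle⊆quad a h = ∈quad⁺ ∘ Sum.map₂ (Sum.map₂ inj₁) ∘ ∈triangle⁻

  module _ {𝓑 : Subset v → Set} (sqs : IsSQS 𝓑) (negate-closed : ∀ B → 𝓑 B → 𝓑 (negate B)) where

    closed-triple⇒block-closed : ∀ {T B} → ∣ T ∣ ≡ 3 → NegationClosed T →
      𝓑 B → T ⊆ B → NegationClosed B
    closed-triple⇒block-closed {T} {B} ∣T∣≡3 T-closed 𝓑B T⊆B {y} y∈B =
      ∈-negate⁻ (subst (y ∈_) B≡-B y∈B)
      where
      B≡-B : B ≡ negate B
      B≡-B = proj₂ (proj₂ sqs T ∣T∣≡3) B (negate B) 𝓑B (negate-closed B 𝓑B) T⊆B
               (∈-negate⁺ ∘ T⊆B ∘ T-closed)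

    block-through-triangle : ∀ {h₀} → UniqueInvolution h₀ → ∀ {a B} → ¬ InΩ₁ a →
      𝓑 B → triangle a ⊆ B → B ≡ quad a (- a) h₀
    block-through-triangle {h₀} unique {a} {B} a∉Ω₁ 𝓑B T⊆B = ⊆-antisym B⊆Q Q⊆B
      where
      ∣T∣≡3 : ∣ triangle a ∣ ≡ 3
      ∣T∣≡3 = ∣triangle∣≡3 a∉Ω₁
      ∣B∣≡4 : ∣ B ∣ ≡ 4
      ∣B∣≡4 = proj₁ sqs B 𝓑B

      outside≡h₀ : ∀ {y} → y ∈ B → y ∉ triangle a → y ≡ h₀
      outside≡h₀ {y} y∈B y∉T
        with unique y (≡-⇒InΩ₁ (outside-point-self-inverse (triangle-closed a)
               (closed-triple⇒block-closed ∣T∣≡3 (triangle-closed a) 𝓑B T⊆B) T⊆B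
               (subst₂ _≤_ (sym ∣B∣≡4) (cong suc (sym ∣T∣≡3)) ≤-refl) y∈B y∉T))
      ... | inj₁ y≡0  = contradiction (∈triangle⁺ (inj₁ y≡0)) y∉T
      ... | inj₂ y≡h₀ = y≡h₀

      h₀∈B : h₀ ∈ B
      h₀∈B with h₀ ∈? B
      ... | yes h₀∈B = h₀∈B
      ... | no  h₀∉B = contradiction (subst₂ _≤_ ∣B∣≡4 ∣T∣≡3 (p⊆q⇒∣p∣≤∣q∣ B⊆T)) 1+n≰n
        where
        B⊆T : B ⊆ triangle a
        B⊆T {y} y∈B with y ∈? triangle a
        ... | yes y∈T = y∈T
        ... | no  y∉T = contradiction (subst (_∈ B) (outside≡h₀ y∈B y∉T) y∈B) h₀∉B

      B⊆Q : B ⊆ quad a (- a) h₀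
      B⊆Q {y} y∈B with y ∈? triangle a
      ... | yes y∈T = triangle⊆quad a h₀ y∈T
      ... | no  y∉T = ∈quad⁺ (inj₂ (inj₂ (inj₂ (outside≡h₀ y∈B y∉T))))

      Q⊆B : quad a (- a) h₀ ⊆ B
      Q⊆B y∈Q with ∈quad⁻ y∈Q
      ... | inj₁ refl               = T⊆B (∈triangle⁺ (inj₁ refl))
      ... | inj₂ (inj₁ refl)        = T⊆B (∈triangle⁺ (inj₂ (inj₁ refl)))
      ... | inj₂ (inj₂ (inj₁ refl)) = T⊆B (∈triangle⁺ (inj₂ (inj₂ refl)))
      ... | inj₂ (inj₂ (inj₂ refl)) = h₀∈B

    quad-is-block : ∀ {h₀} → UniqueInvolution h₀ → ∀ {a} → ¬ InΩ₁ a → 𝓑 (quad a (- a) h₀)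
    quad-is-block unique {a} a∉Ω₁ with proj₁ (proj₂ sqs (triangle a) (∣triangle∣≡3 a∉Ω₁))
    ... | B , 𝓑B , T⊆B = subst 𝓑 (block-through-triangle unique a∉Ω₁ 𝓑B T⊆B) 𝓑B

  orbit-closed : ∀ {𝓑 : Subset v → Set} → (∀ B → 𝓑 B → ∀ a → 𝓑 (translate B a)) →
    (∀ B → 𝓑 B → 𝓑 (negate B)) → ∀ {X Y} → 𝓑 Y → SameOrbit X Y → 𝓑 X
  orbit-closed {𝓑} translate-closed negate-closed {X} {Y} 𝓑Y X~Y
    with Equivalence.to (X~Y X) (0# , inj₁ (sym (translate-identity X)))
  ... | c , inj₁ X≡Y+c  = subst 𝓑 (sym X≡Y+c) (translate-closed Y 𝓑Y c)
  ... | c , inj₂ X≡-Y+c = subst 𝓑 (sym X≡-Y+c) (translate-closed (negate Y) (negate-closed Y 𝓑Y) c)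

-- The congruence on v only ensures that an SQS(v) exists.
lemma6p4 : (v : ℕ) (G : FinAbGroup v) → (v % 6 ≡ 2 ⊎ v % 6 ≡ 4)
    → GroupNotions.Sylow2Cyclic G
    → (h₀ : Fin v) → GroupNotions.OrderTwo G h₀
    → (𝓑 : Subset v → Set) → GroupNotions.IsSQS G 𝓑 → GroupNotions.Reversible G 𝓑
    → ∀ X → GroupNotions.InB₀ G h₀ X → 𝓑 X
lemma6p4 v G _ cyclic h₀ h₀-order-two 𝓑 sqs (_ , translate-closed , negate-closed) X (_ , X∈Q₁∪Q₂∪Q₃) =
  [ (λ (a , a∉Ω₁ , X~Q) → orbit-closed G translate-closed negate-closed
                             (quad-is-block G sqs negate-closed unique a∉Ω₁) X~Q)
  , [ ⊥-elim ∘ UniqueInvolution⇒¬InQ₂ G unique X , ⊥-elim ∘ UniqueInvolution⇒¬InQ₃ G unique X ]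
  ] X∈Q₁∪Q₂∪Q₃
  where
  unique : UniqueInvolution G h₀
  unique = Sylow2Cyclic⇒UniqueInvolution G cyclic h₀-order-two
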